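{- Let $\mathbf{G}$ be a finite abelian group, let $X,Y\subset\mathbf{G}$ be non-empty with $|X|=n$, let $\varepsilon\in(0,1/2]$, let $K>0$, and let $A\subset\mathbf{G}$. If $$\mathbf{E}(X,Y)\le|X|^2|Y|/K,\qquad |\sigma_A(X,Y)|\ge\varepsilon,$$ then for some $k>\varepsilon^4|Y|K/(4n)$ there are $y_1,\dots,y_k\in Y$ satisfying $$\Bigl|(X+y_i)\cap\Bigl(\bigcup_{j=1}^{i-1}(X+y_j)\Bigr)\Bigr|\le\varepsilon n/2\qquad(i=2,\dots,k)$$ and $$|\sigma_A(X,y_j)|\ge\varepsilon/2\qquad(j=1,\dots,k).$$
   Context: The additive energy is $\mathbf{E}(X,Y)=|\{(x_1,x_2,y_1,y_2)\in X\times X\times Y\times Y: x_1+y_1=x_2+y_2\}|$. For $y\in\mathbf{G}$, $X+y=\{x+y:x\in X\}$. For finite non-empty $X,Y\subset\mathbf{G}$ and $A\subset\mathbf{G}$, $\sigma_A(X,Y)=\frac{1}{|X||Y|}\sum_{x\in X}\sum_{y\in Y}A(x+y)-\frac12$, where $A$ also denotes the indicator function of $A$; and $\sigma_A(X,y)=\sigma_A(X,\{y\})$. -}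

module Defs where

open import Data.Bool using (Bool; true; false; if_then_else_; _∧_)
open import Data.Nat using (ℕ; zero; suc) renaming (_+_ to _+ℕ_; _*_ to _*ℕ_)
open import Data.Integer using (+_)
open import Data.Rational using (ℚ; _/_; _-_; ½; 0ℚ)
open import Data.Fin using (Fin; _≟_)
open import Data.List using (List; map; foldr; allFin)
open import Data.Vec using (tabulate; lookup)
open import Data.Fin.Subset using (Subset; ∣_∣; ⁅_⁆)
open import Relation.Nullary.Decidable using (⌊_⌋)
open import Algebra.Core using (Op₁; Op₂)

-- The finite abelian group G is modelled with carrier Fin N (every finite
-- group is isomorphic to one on Fin |G|), with operation _∙_, identity and
-- inverse _⁻¹ (the abelian-group axioms are hypotheses of the theorem).

ℕ→ℚ : ℕ → ℚ
ℕ→ℚ n = (+ n) / 1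

Σ[_] : ∀ {N} → (Fin N → ℕ) → ℕ
Σ[_] {N} f = foldr _+ℕ_ 0 (map f (allFin N))

[_] : Bool → ℕ
[ b ] = if b then 1 else 0

module _ {N : ℕ} (_∙_ : Op₂ (Fin N)) (_⁻¹ : Op₁ (Fin N)) where

  energy : Subset N → Subset N → ℕ
  energy X Y =
    Σ[ (λ x₁ → Σ[ (λ x₂ → Σ[ (λ y₁ → Σ[ (λ y₂ →
      [ lookup X x₁ ∧ lookup X x₂ ∧ lookup Y y₁ ∧ lookup Y y₂
        ∧ ⌊ (x₁ ∙ y₁) ≟ (x₂ ∙ y₂) ⌋ ]) ]) ]) ]) ]

  -- translate X + y = {x + y : x ∈ X}  (g ∈ X + y  iff  g - y ∈ X)
  translate : Subset N → Fin N → Subset N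
  translate X y = tabulate (λ g → lookup X (g ∙ (y ⁻¹)))

  hits : Subset N → Subset N → Subset N → ℕ
  hits A X Y = Σ[ (λ x → Σ[ (λ y →
    [ lookup X x ∧ lookup Y y ∧ lookup A (x ∙ y) ]) ]) ]

  -- a / b as a rational (b = 0 only arises for empty sets, excluded by hypotheses)
  frac : ℕ → ℕ → ℚ
  frac a zero = 0ℚ
  frac a (suc b) = (+ a) / suc b

  σ : Subset N → Subset N → Subset N → ℚ
  σ A X Y = frac (hits A X Y) (∣ X ∣ *ℕ ∣ Y ∣) - ½

  σ₁ : Subset N → Subset N → Fin N → ℚ
  σ₁ A X y = σ A X ⁅ y ⁆

-- Let Y′ be the set of y ∈ Y with |σ_A(X,y)| ≥ ε/2. Since σ_A(X,Y) is the average of the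
-- σ_A(X,y) over y ∈ Y and always |σ_A(X,y)| ≤ 1/2, we get |Y′| ≥ ε|Y|. Run once through the
-- group, keeping y ∈ Y′ whenever X + y meets the union U of the translates kept so far in at
-- most εn/2 points; afterwards every y ∈ Y′ meets U in more than εn/2 points (a kept one in
-- all n of them). With r(g) the number of ways to write g = x + y, x ∈ X, y ∈ Y′,
-- Cauchy–Schwarz gives
--   (ε|Y| · εn/2)² < (∑_{y∈Y′} |(X + y) ∩ U|)² = (∑_{g∈U} r(g))² ≤ |U| ∑_g r(g)²
--                  ≤ kn · E(X,Y) ≤ kn · n²|Y|/K,
-- that is, k > ε⁴|Y|K/(4n).

module Submission where

open import Defs
open import Data.Bool using (true; false; _∧_)
open import Data.Fin using (Fin; zero; suc; toℕ)
open import Data.Fin.Subset using (Subset; _∈_; _⊆_; _∩_; _∪_; ⋃; ∣_∣; ⁅_⁆; Nonempty)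
open import Data.Fin.Subset.Properties using (x∈p∩q⁺; x∈p∩q⁻; x∈p∪q⁻; p⊆p∪q; q⊆p∪q; ⊥⊆)
open import Data.List as List using (List; []; _∷_; _++_; _∷ʳ_; allFin)
open import Data.List.Properties using (++-identityʳ; ++-assoc)
open import Data.List.Relation.Unary.All as All using (All; []; _∷_)
open import Data.List.Relation.Unary.Any using (here; there)
open import Data.List.Membership.Propositional using () renaming (_∈_ to _∈ₗ_)
open import Data.List.Membership.Propositional.Properties using (∈-++⁺ˡ; ∈-++⁺ʳ)
open import Data.Product using (_,_; _×_; ∃; proj₁; proj₂)
open import Data.Sum using (_⊎_; inj₁; inj₂; [_,_]′)
open import Function using (_∘_)
open import Relation.Binary.PropositionalEquality hiding ([_])
open import Relation.Nullary using (¬_; Dec; yes; no)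
open import Algebra.Core using (Op₁; Op₂)
open import Algebra.Structures using (IsAbelianGroup)

⊆⋃ : ∀ {N} {p : Subset N} {ps} → p ∈ₗ ps → p ⊆ ⋃ ps
⊆⋃ {ps = q ∷ ps} (here refl) = p⊆p∪q (⋃ ps)
⊆⋃ {ps = q ∷ ps} (there p∈ps) = q⊆p∪q q (⋃ ps) ∘ ⊆⋃ p∈ps

⋃-least : ∀ {N} {ps} {q : Subset N} → (∀ {p} → p ∈ₗ ps → p ⊆ q) → ⋃ ps ⊆ q
⋃-least {ps = []} _ = ⊥⊆
⋃-least {ps = p ∷ ps} ps⊆q x∈⋃ =
  [ ps⊆q (here refl) , ⋃-least (ps⊆q ∘ there) ]′ (x∈p∪q⁻ p (⋃ ps) x∈⋃)

Chain : ∀ {A : Set} → (List A → A → Set) → List A → Set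
Chain P zs = (i : Fin (List.length zs)) → P (List.take (toℕ i) zs) (List.lookup zs i)

Chain-∷ʳ : ∀ {A : Set} {P : List A → A → Set} zs {z} → Chain P zs → P zs z → Chain P (zs ∷ʳ z)
Chain-∷ʳ [] _ Pz zero = Pz
Chain-∷ʳ (x ∷ zs) chain Pz zero = chain zero
Chain-∷ʳ {P = P} (x ∷ zs) chain Pz (suc i) =
  Chain-∷ʳ {P = λ ws → P (x ∷ ws)} zs (chain ∘ suc) Pz i

Chain⇒All : ∀ {A : Set} {P : List A → A → Set} {Q : A → Set} →
  (∀ {ws z} → P ws z → Q z) → ∀ zs → Chain P zs → All Q zs
Chain⇒All P⇒Q [] chain = []
Chain⇒All {P = P} P⇒Q (x ∷ zs) chain =
  P⇒Q (chain zero) ∷ Chain⇒All {P = λ ws → P (x ∷ ws)} P⇒Q zs (chain ∘ suc)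

module Greedy {A : Set} (P : List A → A → Set) (P? : ∀ zs z → Dec (P zs z)) where

  greedy : List A → List A → List A
  greedy zs [] = zs
  greedy zs (c ∷ cs) with P? zs c
  ... | yes _ = greedy (zs ∷ʳ c) cs
  ... | no _ = greedy zs cs

  greedy-chain : ∀ zs cs → Chain P zs → Chain P (greedy zs cs)
  greedy-chain zs [] chain = chain
  greedy-chain zs (c ∷ cs) chain with P? zs c
  ... | yes Pc = greedy-chain (zs ∷ʳ c) cs (Chain-∷ʳ {P = P} zs chain Pc)
  ... | no _ = greedy-chain zs cs chain

  greedy-extends : ∀ zs cs → ∃ λ ws → greedy zs cs ≡ zs ++ ws
  greedy-extends zs [] = [] , sym (++-identityʳ zs)
  greedy-extends zs (c ∷ cs) with P? zs c
  ... | no _ = greedy-extends zs cs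
  ... | yes _ with ws , eq ← greedy-extends (zs ∷ʳ c) cs =
    c ∷ ws , trans eq (++-assoc zs (c ∷ []) ws)

  greedy-maximal : (∀ zs ws c → P (zs ++ ws) c → P zs c) →
    ∀ zs cs {c} → c ∈ₗ cs → c ∈ₗ greedy zs cs ⊎ ¬ P (greedy zs cs) c
  greedy-maximal antitone zs (c ∷ cs) (here refl) with P? zs c
  ... | yes _ with ws , eq ← greedy-extends (zs ∷ʳ c) cs =
    inj₁ (subst (c ∈ₗ_) (sym eq) (∈-++⁺ˡ (∈-++⁺ʳ zs (here refl))))
  ... | no ¬Pc with ws , eq ← greedy-extends zs cs =
    inj₂ (¬Pc ∘ antitone zs ws c ∘ subst (λ ys → P ys c) eq)
  greedy-maximal antitone zs (d ∷ cs) (there c∈cs) with P? zs d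
  ... | yes _ = greedy-maximal antitone (zs ∷ʳ d) cs c∈cs
  ... | no _ = greedy-maximal antitone zs cs c∈cs


module Counting where

  open import Data.Nat as ℕ using (ℕ; zero; suc; _+_; _*_; _≤_; z≤n; s≤s)
  open import Data.Nat.Properties as ℕ using (+-*-semiring)
  open import Data.Nat.Tactic.RingSolver using (solve-∀)
  open import Data.Fin using (_≟_)
  open import Data.Fin.Subset.Properties
    using (∣p∣≤∣x∷p∣; ∣⊥∣≡0; ∣⁅x⁆∣≡1; p⊆q⇒∣p∣≤∣q∣; x∈⁅y⁆⇒x≡y; nonempty?; Empty-unique)
  open import Data.Empty using (⊥-elim)
  open import Data.Fin.Permutation using (permutation)
  open import Data.Vec using ([]; _∷_; lookup)
  open import Data.Vec.Properties
    using ([]=⇒lookup; lookup⇒[]=; lookup-zipWith; lookup-replicate; lookup∘tabulate)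
  open import Relation.Nullary.Decidable using (⌊_⌋; ⌊⌋-map′)
  open import Level using (0ℓ)
  open import Algebra.Bundles using (Group)
  open import Algebra.Structures using (IsGroup)
  import Algebra.Properties.Group as GroupProperties
  open import Algebra.Properties.CommutativeSemigroup ℕ.*-commutativeSemigroup
    using (x∙yz≈y∙xz; x∙yz≈yx∙z)
  open import Algebra.Properties.Semiring.Sum +-*-semiring

  χ : ∀ {N} → Subset N → Fin N → ℕ
  χ p i = [ lookup p i ]

  δ : ∀ {N} → Fin N → Fin N → ℕ
  δ i j = [ ⌊ i ≟ j ⌋ ]

  [∧]≡[]*[] : ∀ a b → [ a ∧ b ] ≡ [ a ] * [ b ]
  [∧]≡[]*[] false b = refl
  [∧]≡[]*[] true b = sym (ℕ.+-identityʳ [ b ])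

  Σ≡∑ : ∀ {N} (f : Fin N → ℕ) → Σ[ f ] ≡ sum f
  Σ≡∑ {N} f = foldr-tabulate N (λ i → i)
    where
    foldr-tabulate : ∀ M (g : Fin M → Fin N) →
      List.foldr _+_ 0 (List.map f (List.tabulate g)) ≡ sum (f ∘ g)
    foldr-tabulate zero g = refl
    foldr-tabulate (suc M) g = cong (f (g zero) +_) (foldr-tabulate M (g ∘ suc))

  Σ≡∑-cong : ∀ {N} {f g : Fin N → ℕ} → (∀ i → f i ≡ g i) → Σ[ f ] ≡ sum g
  Σ≡∑-cong {f = f} f≗g = trans (Σ≡∑ f) (sum-cong-≗ f≗g)

  ∑-mono-≤ : ∀ {N} {f g : Fin N → ℕ} → (∀ i → f i ≤ g i) → sum f ≤ sum g
  ∑-mono-≤ {zero} f≤g = z≤n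
  ∑-mono-≤ {suc N} f≤g = ℕ.+-mono-≤ (f≤g zero) (∑-mono-≤ (f≤g ∘ suc))

  ∑-δ : ∀ {N} (j : Fin N) (f : Fin N → ℕ) → ∑[ i < N ] (δ i j * f i) ≡ f j
  ∑-δ {suc N} zero f = begin
    1 * f zero + ∑[ i < N ] 0  ≡⟨ cong₂ _+_ (ℕ.*-identityˡ (f zero)) (sum-replicate-zero N) ⟩
    f zero + 0                 ≡⟨ ℕ.+-identityʳ (f zero) ⟩
    f zero                     ∎
    where open ≡-Reasoning
  ∑-δ {suc N} (suc j) f = trans (sum-cong-≗ δ-suc) (∑-δ j (f ∘ suc))
    where
    δ-suc : ∀ i → δ (suc i) (suc j) * f (suc i) ≡ δ i j * f (suc i)
    δ-suc i = cong (λ b → [ b ] * f (suc i)) (⌊⌋-map′ _ _ (i ≟ j))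

  ∣p∣≡∑χ : ∀ {N} (p : Subset N) → ∣ p ∣ ≡ sum (χ p)
  ∣p∣≡∑χ [] = refl
  ∣p∣≡∑χ (true ∷ p) = cong suc (∣p∣≡∑χ p)
  ∣p∣≡∑χ (false ∷ p) = ∣p∣≡∑χ p

  ∑*∑ : ∀ {M N} (f : Fin M → ℕ) (g : Fin N → ℕ) → sum f * sum g ≡ ∑[ i < M ] ∑[ j < N ] (f i * g j)
  ∑*∑ f g = trans (*-distribʳ-sum (sum g) f) (sum-cong-≗ (λ i → *-distribˡ-sum (f i) g))

  *-distribˡ-∑∑ : ∀ {M N} c (h : Fin M → Fin N → ℕ) →
    c * ∑[ i < M ] ∑[ j < N ] h i j ≡ ∑[ i < M ] ∑[ j < N ] (c * h i j)
  *-distribˡ-∑∑ {N = N} c h =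
    trans (*-distribˡ-sum c (λ i → ∑[ j < N ] h i j)) (sum-cong-≗ (λ i → *-distribˡ-sum c (h i)))

  2xy≤x²+y² : ∀ x y → 2 * (x * y) ≤ x * x + y * y
  2xy≤x²+y² x y = [ below , above ]′ (ℕ.≤-total x y)
    where
    below : ∀ {x y} → x ≤ y → 2 * (x * y) ≤ x * x + y * y
    below {x} x≤y with d , refl ← ℕ.m≤n⇒∃[o]m+o≡n x≤y =
      subst (2 * (x * (x + d)) ≤_) (square-gap x d) (ℕ.m≤m+n _ (d * d))
      where
      square-gap : ∀ x d → 2 * (x * (x + d)) + d * d ≡ x * x + (x + d) * (x + d)
      square-gap = solve-∀
    above : y ≤ x → 2 * (x * y) ≤ x * x + y * y
    above y≤x = subst₂ _≤_ (cong (2 *_) (ℕ.*-comm y x)) (ℕ.+-comm (y * y) (x * x)) (below y≤x)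

  cauchy-schwarz : ∀ {N} (f g : Fin N → ℕ) →
    sum (λ i → f i * g i) * sum (λ i → f i * g i) ≤ sum (λ i → f i * f i) * sum (λ i → g i * g i)
  cauchy-schwarz {N} f g = ℕ.*-cancelˡ-≤ 2 (begin
    2 * (∑fg * ∑fg)
      ≡⟨ cong (2 *_) (∑*∑ fg fg) ⟩
    2 * ∑[ i < N ] ∑[ j < N ] (fg i * fg j)
      ≡⟨ *-distribˡ-∑∑ 2 (λ i j → fg i * fg j) ⟩
    ∑[ i < N ] ∑[ j < N ] (2 * (fg i * fg j))
      ≤⟨ ∑-mono-≤ (λ i → ∑-mono-≤ (λ j → cross i j)) ⟩
    ∑[ i < N ] ∑[ j < N ] (ff i * gg j + ff j * gg i)
      ≡⟨ sum-cong-≗ (λ i → ∑-distrib-+ (λ j → ff i * gg j) (λ j → ff j * gg i)) ⟩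
    ∑[ i < N ] (∑[ j < N ] (ff i * gg j) + ∑[ j < N ] (ff j * gg i))
      ≡⟨ ∑-distrib-+ (λ i → ∑[ j < N ] (ff i * gg j)) (λ i → ∑[ j < N ] (ff j * gg i)) ⟩
    ∑[ i < N ] ∑[ j < N ] (ff i * gg j) + ∑[ i < N ] ∑[ j < N ] (ff j * gg i)
      ≡⟨ cong₂ _+_ (sym (∑*∑ ff gg)) (trans (∑-comm (λ i j → ff j * gg i)) (sym (∑*∑ ff gg))) ⟩
    ∑ff * ∑gg + ∑ff * ∑gg
      ≡⟨ cong (∑ff * ∑gg +_) (sym (ℕ.+-identityʳ _)) ⟩
    2 * (∑ff * ∑gg) ∎)
    where
    open ℕ.≤-Reasoning
    fg ff gg : Fin N → ℕ
    fg i = f i * g i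
    ff i = f i * f i
    gg i = g i * g i
    ∑fg = sum fg
    ∑ff = sum ff
    ∑gg = sum gg
    cross : ∀ i j → 2 * (fg i * fg j) ≤ ff i * gg j + ff j * gg i
    cross i j = subst₂ _≤_ (cong (2 *_) (swap (f i) (g i) (f j) (g j))) (squares (f i) (g i) (f j) (g j))
                  (2xy≤x²+y² (f i * g j) (f j * g i))
      where
      swap : ∀ a b c d → (a * d) * (c * b) ≡ (a * b) * (c * d)
      swap = solve-∀
      squares : ∀ a b c d → (a * d) * (a * d) + (c * b) * (c * b) ≡ (a * a) * (d * d) + (c * c) * (b * b)
      squares = solve-∀

  χ-∩ : ∀ {N} (p q : Subset N) i → χ (p ∩ q) i ≡ χ p i * χ q i
  χ-∩ p q i = trans (cong [_] (lookup-zipWith _∧_ i p q)) ([∧]≡[]*[] (lookup p i) (lookup q i))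

  χ≤1 : ∀ {N} (p : Subset N) i → χ p i ≤ 1
  χ≤1 p i with lookup p i
  ... | false = z≤n
  ... | true = ℕ.≤-refl

  χ-idem : ∀ {N} (p : Subset N) i → χ p i * χ p i ≡ χ p i
  χ-idem p i with lookup p i
  ... | false = refl
  ... | true = refl

  χ-mono : ∀ {N} {p q : Subset N} → p ⊆ q → ∀ i → χ p i ≤ χ q i
  χ-mono {p = p} {q} p⊆q i with lookup p i in eq
  ... | false = z≤n
  ... | true rewrite []=⇒lookup (p⊆q (lookup⇒[]= i p eq)) = ℕ.≤-refl

  χ⁅⁆ : ∀ {N} (j i : Fin N) → χ ⁅ j ⁆ i ≡ δ i j
  χ⁅⁆ zero zero = refl
  χ⁅⁆ zero (suc i) = cong [_] (lookup-replicate i false)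
  χ⁅⁆ (suc j) zero = refl
  χ⁅⁆ (suc j) (suc i) = trans (χ⁅⁆ j i) (cong [_] (sym (⌊⌋-map′ _ _ (i ≟ j))))

  -- energy and hits take an inverse they never use, so it cannot be inferred and is
  -- passed explicitly where needed.
  module _ {N : ℕ} (_∙_ : Op₂ (Fin N)) where

    rep : Subset N → Subset N → Fin N → ℕ
    rep X Y g = ∑[ x < N ] ∑[ y < N ] (χ X x * χ Y y * δ g (x ∙ y))

    ∑-rep : ∀ X Y (F : Fin N → ℕ) →
      ∑[ g < N ] (rep X Y g * F g) ≡ ∑[ x < N ] ∑[ y < N ] (χ X x * χ Y y * F (x ∙ y))
    ∑-rep X Y F = begin
      ∑[ g < N ] (rep X Y g * F g)
        ≡⟨ sum-cong-≗ (λ g → trans (*-distribʳ-sum (F g) (λ x → ∑[ y < N ] term x y g))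
                                   (sum-cong-≗ (λ x → *-distribʳ-sum (F g) (λ y → term x y g)))) ⟩
      ∑[ g < N ] ∑[ x < N ] ∑[ y < N ] (χ X x * χ Y y * δ g (x ∙ y) * F g)
        ≡⟨ ∑-comm (λ g x → ∑[ y < N ] (term x y g * F g)) ⟩
      ∑[ x < N ] ∑[ g < N ] ∑[ y < N ] (χ X x * χ Y y * δ g (x ∙ y) * F g)
        ≡⟨ sum-cong-≗ (λ x → ∑-comm (λ g y → term x y g * F g)) ⟩
      ∑[ x < N ] ∑[ y < N ] ∑[ g < N ] (χ X x * χ Y y * δ g (x ∙ y) * F g)
        ≡⟨ sum-cong-≗ (λ x → sum-cong-≗ (λ y → collapse (χ X x * χ Y y) (x ∙ y))) ⟩
      ∑[ x < N ] ∑[ y < N ] (χ X x * χ Y y * F (x ∙ y)) ∎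
      where
      open ≡-Reasoning
      term : Fin N → Fin N → Fin N → ℕ
      term x y g = χ X x * χ Y y * δ g (x ∙ y)
      collapse : ∀ c j → ∑[ g < N ] (c * δ g j * F g) ≡ c * F j
      collapse c j = trans (sum-cong-≗ (λ g → ℕ.*-assoc c (δ g j) (F g)))
                           (trans (sym (*-distribˡ-sum c (λ g → δ g j * F g))) (cong (c *_) (∑-δ j F)))

    energy≡∑rep² : ∀ {inv : Op₁ (Fin N)} X Y → energy _∙_ inv X Y ≡ ∑[ g < N ] (rep X Y g * rep X Y g)
    energy≡∑rep² {inv} X Y = begin
      energy _∙_ inv X Y
        ≡⟨ Σ≡∑-cong (λ x₁ → Σ≡∑-cong (λ x₂ → Σ≡∑-cong (λ y₁ → Σ≡∑-cong (λ y₂ → expand x₁ x₂ y₁ y₂)))) ⟩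
      ∑[ x₁ < N ] ∑[ x₂ < N ] ∑[ y₁ < N ] ∑[ y₂ < N ] term x₁ x₂ y₁ y₂
        ≡⟨ sum-cong-≗ (λ x₁ → ∑-comm (λ x₂ y₁ → ∑[ y₂ < N ] term x₁ x₂ y₁ y₂)) ⟩
      ∑[ x₁ < N ] ∑[ y₁ < N ] ∑[ x₂ < N ] ∑[ y₂ < N ] term x₁ x₂ y₁ y₂
        ≡⟨ sum-cong-≗ (λ x₁ → sum-cong-≗ (λ y₁ → factor x₁ y₁)) ⟩
      ∑[ x₁ < N ] ∑[ y₁ < N ] (χ X x₁ * χ Y y₁ * rep X Y (x₁ ∙ y₁))
        ≡⟨ ∑-rep X Y (rep X Y) ⟨
      ∑[ g < N ] (rep X Y g * rep X Y g) ∎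
      where
      open ≡-Reasoning
      term : Fin N → Fin N → Fin N → Fin N → ℕ
      term x₁ x₂ y₁ y₂ = χ X x₁ * (χ X x₂ * (χ Y y₁ * (χ Y y₂ * δ (x₁ ∙ y₁) (x₂ ∙ y₂))))
      expand : ∀ x₁ x₂ y₁ y₂ →
        [ lookup X x₁ ∧ lookup X x₂ ∧ lookup Y y₁ ∧ lookup Y y₂ ∧ ⌊ x₁ ∙ y₁ ≟ x₂ ∙ y₂ ⌋ ] ≡ term x₁ x₂ y₁ y₂
      expand x₁ x₂ y₁ y₂ =
        trans ([∧]≡[]*[] (lookup X x₁) _) (cong (χ X x₁ *_)
        (trans ([∧]≡[]*[] (lookup X x₂) _) (cong (χ X x₂ *_)
        (trans ([∧]≡[]*[] (lookup Y y₁) _) (cong (χ Y y₁ *_)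
        ([∧]≡[]*[] (lookup Y y₂) _))))))
      regroup : ∀ a b c d e → a * (b * (c * (d * e))) ≡ a * c * (b * d * e)
      regroup = solve-∀
      factor : ∀ x₁ y₁ → ∑[ x₂ < N ] ∑[ y₂ < N ] term x₁ x₂ y₁ y₂ ≡ χ X x₁ * χ Y y₁ * rep X Y (x₁ ∙ y₁)
      factor x₁ y₁ = trans
        (sum-cong-≗ (λ x₂ → sum-cong-≗ (λ y₂ → regroup (χ X x₁) (χ X x₂) (χ Y y₁) (χ Y y₂) _)))
        (sym (*-distribˡ-∑∑ (χ X x₁ * χ Y y₁) (λ x₂ y₂ → χ X x₂ * χ Y y₂ * δ (x₁ ∙ y₁) (x₂ ∙ y₂))))

    rep-mono : ∀ X {Y′ Y} → Y′ ⊆ Y → ∀ g → rep X Y′ g ≤ rep X Y g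
    rep-mono X Y′⊆Y g = ∑-mono-≤ (λ x → ∑-mono-≤ (λ y →
      ℕ.*-monoˡ-≤ (δ g (x ∙ y)) (ℕ.*-monoʳ-≤ (χ X x) (χ-mono Y′⊆Y y))))

    hits≡∑ : ∀ {inv : Op₁ (Fin N)} A X Y →
      hits _∙_ inv A X Y ≡ ∑[ x < N ] ∑[ y < N ] (χ X x * (χ Y y * χ A (x ∙ y)))
    hits≡∑ A X Y = Σ≡∑-cong (λ x → Σ≡∑-cong (λ y →
      trans ([∧]≡[]*[] (lookup X x) _) (cong (χ X x *_) ([∧]≡[]*[] (lookup Y y) _))))

    hits-⁅⁆ : ∀ {inv : Op₁ (Fin N)} A X y → hits _∙_ inv A X ⁅ y ⁆ ≡ ∑[ x < N ] (χ X x * χ A (x ∙ y))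
    hits-⁅⁆ {inv} A X y = trans (hits≡∑ {inv} A X ⁅ y ⁆) (sum-cong-≗ (λ x → begin
      ∑[ y′ < N ] (χ X x * (χ ⁅ y ⁆ y′ * χ A (x ∙ y′)))
        ≡⟨ *-distribˡ-sum (χ X x) (λ y′ → χ ⁅ y ⁆ y′ * χ A (x ∙ y′)) ⟨
      χ X x * ∑[ y′ < N ] (χ ⁅ y ⁆ y′ * χ A (x ∙ y′))
        ≡⟨ cong (χ X x *_) (sum-cong-≗ (λ y′ → cong (_* χ A (x ∙ y′)) (χ⁅⁆ y y′))) ⟩
      χ X x * ∑[ y′ < N ] (δ y′ y * χ A (x ∙ y′))
        ≡⟨ cong (χ X x *_) (∑-δ y (λ y′ → χ A (x ∙ y′))) ⟩
      χ X x * χ A (x ∙ y) ∎))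
      where open ≡-Reasoning

    hits≡∑hits-⁅⁆ : ∀ {inv : Op₁ (Fin N)} A X Y →
      hits _∙_ inv A X Y ≡ ∑[ y < N ] (χ Y y * hits _∙_ inv A X ⁅ y ⁆)
    hits≡∑hits-⁅⁆ {inv} A X Y = begin
      hits _∙_ inv A X Y
        ≡⟨ hits≡∑ {inv} A X Y ⟩
      ∑[ x < N ] ∑[ y < N ] (χ X x * (χ Y y * χ A (x ∙ y)))
        ≡⟨ ∑-comm (λ x y → χ X x * (χ Y y * χ A (x ∙ y))) ⟩
      ∑[ y < N ] ∑[ x < N ] (χ X x * (χ Y y * χ A (x ∙ y)))
        ≡⟨ sum-cong-≗ (λ y → sum-cong-≗ (λ x → x∙yz≈y∙xz (χ X x) (χ Y y) _)) ⟩
      ∑[ y < N ] ∑[ x < N ] (χ Y y * (χ X x * χ A (x ∙ y)))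
        ≡⟨ sum-cong-≗ (λ y → *-distribˡ-sum (χ Y y) (λ x → χ X x * χ A (x ∙ y))) ⟨
      ∑[ y < N ] (χ Y y * ∑[ x < N ] (χ X x * χ A (x ∙ y)))
        ≡⟨ sum-cong-≗ (λ y → cong (χ Y y *_) (hits-⁅⁆ {inv} A X y)) ⟨
      ∑[ y < N ] (χ Y y * hits _∙_ inv A X ⁅ y ⁆) ∎
      where open ≡-Reasoning

    hits-⁅⁆≤∣X∣ : ∀ {inv : Op₁ (Fin N)} A X y → hits _∙_ inv A X ⁅ y ⁆ ≤ ∣ X ∣
    hits-⁅⁆≤∣X∣ {inv} A X y = subst₂ _≤_ (sym (hits-⁅⁆ {inv} A X y)) (sym (∣p∣≡∑χ X)) (∑-mono-≤ χX*χA≤χX)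
      where
      χX*χA≤χX : ∀ x → χ X x * χ A (x ∙ y) ≤ χ X x
      χX*χA≤χX x = subst (χ X x * χ A (x ∙ y) ≤_) (ℕ.*-identityʳ (χ X x)) (ℕ.*-monoʳ-≤ (χ X x) (χ≤1 A (x ∙ y)))

  module _ {N : ℕ} {_∙_ : Op₂ (Fin N)} {e : Fin N} {_⁻¹ : Op₁ (Fin N)}
    (isGroup : IsGroup _≡_ _∙_ e _⁻¹) where

    private
      group : Group 0ℓ 0ℓ
      group = record { Carrier = Fin N ; _≈_ = _≡_ ; _∙_ = _∙_ ; ε = e ; _⁻¹ = _⁻¹ ; isGroup = isGroup }

    open GroupProperties group using (//-rightDividesˡ; //-rightDividesʳ)

    ∑-translate : ∀ y (F : Fin N → ℕ) → sum F ≡ ∑[ x < N ] F (x ∙ y)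
    ∑-translate y F =
      sum-permute F (permutation (_∙ y) (_∙ (y ⁻¹)) (//-rightDividesˡ y) (//-rightDividesʳ y))

    ∑χ-translate : ∀ X y (F : Fin N → ℕ) →
      ∑[ g < N ] (χ (translate _∙_ _⁻¹ X y) g * F g) ≡ ∑[ x < N ] (χ X x * F (x ∙ y))
    ∑χ-translate X y F = trans (∑-translate y (λ g → χ (translate _∙_ _⁻¹ X y) g * F g)) (sum-cong-≗ untranslate)
      where
      untranslate : ∀ x → χ (translate _∙_ _⁻¹ X y) (x ∙ y) * F (x ∙ y) ≡ χ X x * F (x ∙ y)
      untranslate x = cong (λ b → [ b ] * F (x ∙ y))
        (trans (lookup∘tabulate _ (x ∙ y)) (cong (lookup X) (//-rightDividesʳ y x)))

    ∣translate∣ : ∀ X y → ∣ translate _∙_ _⁻¹ X y ∣ ≡ ∣ X ∣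
    ∣translate∣ X y = begin
      ∣ X+y ∣                       ≡⟨ ∣p∣≡∑χ X+y ⟩
      ∑[ g < N ] χ X+y g            ≡⟨ sum-cong-≗ (λ g → ℕ.*-identityʳ (χ X+y g)) ⟨
      ∑[ g < N ] (χ X+y g * 1)      ≡⟨ ∑χ-translate X y (λ _ → 1) ⟩
      ∑[ x < N ] (χ X x * 1)        ≡⟨ sum-cong-≗ (λ x → ℕ.*-identityʳ (χ X x)) ⟩
      ∑[ x < N ] χ X x              ≡⟨ ∣p∣≡∑χ X ⟨
      ∣ X ∣                         ∎
      where
      open ≡-Reasoning
      X+y = translate _∙_ _⁻¹ X y

    ∣translate∩∣ : ∀ X y U →
      ∣ translate _∙_ _⁻¹ X y ∩ U ∣ ≡ ∑[ x < N ] (χ X x * χ U (x ∙ y))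
    ∣translate∩∣ X y U = trans (∣p∣≡∑χ (translate _∙_ _⁻¹ X y ∩ U))
      (trans (sum-cong-≗ (χ-∩ (translate _∙_ _⁻¹ X y) U)) (∑χ-translate X y (χ U)))

    ∑∣translate∩∣ : ∀ X Y U →
      ∑[ y < N ] (χ Y y * ∣ translate _∙_ _⁻¹ X y ∩ U ∣) ≡ ∑[ g < N ] (χ U g * rep _∙_ X Y g)
    ∑∣translate∩∣ X Y U = begin
      ∑[ y < N ] (χ Y y * ∣ translate _∙_ _⁻¹ X y ∩ U ∣)
        ≡⟨ sum-cong-≗ (λ y → cong (χ Y y *_) (∣translate∩∣ X y U)) ⟩
      ∑[ y < N ] (χ Y y * ∑[ x < N ] (χ X x * χ U (x ∙ y)))
        ≡⟨ sum-cong-≗ (λ y → *-distribˡ-sum (χ Y y) (λ x → χ X x * χ U (x ∙ y))) ⟩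
      ∑[ y < N ] ∑[ x < N ] (χ Y y * (χ X x * χ U (x ∙ y)))
        ≡⟨ ∑-comm (λ y x → χ Y y * (χ X x * χ U (x ∙ y))) ⟩
      ∑[ x < N ] ∑[ y < N ] (χ Y y * (χ X x * χ U (x ∙ y)))
        ≡⟨ sum-cong-≗ (λ x → sum-cong-≗ (λ y → x∙yz≈yx∙z (χ Y y) (χ X x) _)) ⟩
      ∑[ x < N ] ∑[ y < N ] (χ X x * χ Y y * χ U (x ∙ y))
        ≡⟨ ∑-rep _∙_ X Y (χ U) ⟨
      ∑[ g < N ] (rep _∙_ X Y g * χ U g)
        ≡⟨ sum-cong-≗ (λ g → ℕ.*-comm (rep _∙_ X Y g) (χ U g)) ⟩
      ∑[ g < N ] (χ U g * rep _∙_ X Y g) ∎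
      where open ≡-Reasoning

    overlap-energy : ∀ X {Y′ Y} U → Y′ ⊆ Y →
      let S = ∑[ y < N ] (χ Y′ y * ∣ translate _∙_ _⁻¹ X y ∩ U ∣)
      in S * S ≤ ∣ U ∣ * energy _∙_ _⁻¹ X Y
    overlap-energy X {Y′} {Y} U Y′⊆Y = begin
      S * S
        ≡⟨ cong₂ _*_ (∑∣translate∩∣ X Y′ U) (∑∣translate∩∣ X Y′ U) ⟩
      ∑[ g < N ] (χ U g * r′ g) * ∑[ g < N ] (χ U g * r′ g)
        ≤⟨ cauchy-schwarz (χ U) r′ ⟩
      ∑[ g < N ] (χ U g * χ U g) * ∑[ g < N ] (r′ g * r′ g)
        ≤⟨ ℕ.*-mono-≤ (ℕ.≤-reflexive ∑χ²≡∣U∣) (∑-mono-≤ (λ g → ℕ.*-mono-≤ (r′≤r g) (r′≤r g))) ⟩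
      ∣ U ∣ * ∑[ g < N ] (rep _∙_ X Y g * rep _∙_ X Y g)
        ≡⟨ cong (∣ U ∣ *_) (energy≡∑rep² _∙_ {_⁻¹} X Y) ⟨
      ∣ U ∣ * energy _∙_ _⁻¹ X Y ∎
      where
      open ℕ.≤-Reasoning
      S = ∑[ y < N ] (χ Y′ y * ∣ translate _∙_ _⁻¹ X y ∩ U ∣)
      r′ = rep _∙_ X Y′
      r′≤r = rep-mono _∙_ X Y′⊆Y
      ∑χ²≡∣U∣ : ∑[ g < N ] (χ U g * χ U g) ≡ ∣ U ∣
      ∑χ²≡∣U∣ = trans (sum-cong-≗ (χ-idem U)) (sym (∣p∣≡∑χ U))

  ∣p∪q∣≤∣p∣+∣q∣ : ∀ {N} (p q : Subset N) → ∣ p ∪ q ∣ ≤ ∣ p ∣ + ∣ q ∣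
  ∣p∪q∣≤∣p∣+∣q∣ [] [] = z≤n
  ∣p∪q∣≤∣p∣+∣q∣ (true ∷ p) (b ∷ q) =
    s≤s (ℕ.≤-trans (∣p∪q∣≤∣p∣+∣q∣ p q) (ℕ.+-monoʳ-≤ ∣ p ∣ (∣p∣≤∣x∷p∣ b q)))
  ∣p∪q∣≤∣p∣+∣q∣ (false ∷ p) (true ∷ q) =
    subst (suc ∣ p ∪ q ∣ ≤_) (sym (ℕ.+-suc ∣ p ∣ ∣ q ∣)) (s≤s (∣p∪q∣≤∣p∣+∣q∣ p q))
  ∣p∪q∣≤∣p∣+∣q∣ (false ∷ p) (false ∷ q) = ∣p∪q∣≤∣p∣+∣q∣ p q

  ∣⋃map∣≤ : ∀ {A : Set} {N} (T : A → Subset N) {n} → (∀ a → ∣ T a ∣ ≤ n) →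
    ∀ as → ∣ ⋃ (List.map T as) ∣ ≤ List.length as * n
  ∣⋃map∣≤ {N = N} T ∣T∣≤n [] = ℕ.≤-reflexive (∣⊥∣≡0 N)
  ∣⋃map∣≤ T ∣T∣≤n (a ∷ as) =
    ℕ.≤-trans (∣p∪q∣≤∣p∣+∣q∣ (T a) _) (ℕ.+-mono-≤ (∣T∣≤n a) (∣⋃map∣≤ T ∣T∣≤n as))

  Nonempty⇒NonZero : ∀ {N} {p : Subset N} → Nonempty p → ℕ.NonZero ∣ p ∣
  Nonempty⇒NonZero {p = p} (x , x∈p) = ℕ.>-nonZero (subst (_≤ ∣ p ∣) (∣⁅x⁆∣≡1 x) (p⊆q⇒∣p∣≤∣q∣ ⁅x⁆⊆p))
    where
    ⁅x⁆⊆p : ⁅ x ⁆ ⊆ p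
    ⁅x⁆⊆p y∈⁅x⁆ = subst (_∈ p) (sym (x∈⁅y⁆⇒x≡y x y∈⁅x⁆)) x∈p

  ∣p∣≢0⇒Nonempty : ∀ {N} {p : Subset N} → ∣ p ∣ ≢ 0 → Nonempty p
  ∣p∣≢0⇒Nonempty {N} {p} ∣p∣≢0 with nonempty? p
  ... | yes p≢∅ = p≢∅
  ... | no p≡∅ = ⊥-elim (∣p∣≢0 (trans (cong ∣_∣ (Empty-unique p≡∅)) (∣⊥∣≡0 N)))


module Densities where

  open import Data.Nat as ℕ using (ℕ; zero; suc; NonZero)
  import Data.Nat.Properties as ℕ
  import Data.Integer as ℤ
  import Data.Integer.Properties as ℤ
  open import Data.Rational as ℚ
    using (ℚ; mkℚ; 0ℚ; 1ℚ; ½; _+_; _*_; -_; _-_; _÷_; 1/_; _/_; _≤_; _<_; _≤?_; _<?_; *≤*;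
           Positive; positive; nonNegative)
    renaming (∣_∣ to abs)
  open import Data.Rational.Properties
  import Data.Rational.Unnormalised as ℚᵘ
  import Data.Rational.Unnormalised.Properties as ℚᵘ
  open import Data.Nat.Coprimality using (1-coprimeTo) renaming (sym to coprime-sym)
  open import Data.Fin.Subset.Properties using (∣⁅x⁆∣≡1; _∈?_; p⊆q⇒∣p∣≤∣q∣; x∈p∩q⁺; x∈p∩q⁻)
  open import Data.List.Properties using (map-++)
  open import Data.List.Membership.Propositional.Properties using (∈-allFin; ∈-map⁺)
  open import Data.Vec using (lookup; tabulate)
  open import Data.Vec.Properties using (lookup∘tabulate; []=⇒lookup; lookup⇒[]=)
  open import Data.Empty using (⊥-elim)
  open import Relation.Nullary.Decidable using (⌊_⌋; dec⇒maybe; _×-dec_; from-yes)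
  open import Tactic.RingSolver using (solve-∀)
  import Tactic.RingSolver.Core.AlmostCommutativeRing as ACR
  open import Algebra.Bundles using (CommutativeRing; CommutativeMonoid)
  import Algebra.Properties.Semiring.Sum as SemiringSum
  open import Algebra.Properties.CommutativeSemigroup
    (CommutativeMonoid.commutativeSemigroup *-1-commutativeMonoid) using (x∙yz≈y∙xz; xy∙z≈xz∙y)
  open Counting using (χ; ∣p∣≡∑χ; hits≡∑hits-⁅⁆; hits-⁅⁆≤∣X∣)

  module ℚΣ = SemiringSum (CommutativeRing.semiring +-*-commutativeRing)
  module ℕΣ = SemiringSum ℕ.+-*-semiring
  open ℚΣ using () renaming (sum to ∑)

  -- ℕ→ℚ n = + n / 1 is normalised through a gcd that does not compute for variable n.
  ℕ→ℚ≡mkℚ : ∀ n → ℕ→ℚ n ≡ mkℚ (ℤ.+ n) 0 (coprime-sym (1-coprimeTo n))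
  ℕ→ℚ≡mkℚ n = ↥p/↧p≡p (mkℚ (ℤ.+ n) 0 (coprime-sym (1-coprimeTo n)))

  ℕ→ℚ-+ : ∀ a b → ℕ→ℚ (a ℕ.+ b) ≡ ℕ→ℚ a + ℕ→ℚ b
  ℕ→ℚ-+ a b rewrite ℕ→ℚ≡mkℚ a | ℕ→ℚ≡mkℚ b =
    /-cong (trans (ℤ.pos-+ a b) (cong₂ ℤ._+_ (sym (ℤ.*-identityʳ (ℤ.+ a))) (sym (ℤ.*-identityʳ (ℤ.+ b)))))
           refl

  ℕ→ℚ-* : ∀ a b → ℕ→ℚ (a ℕ.* b) ≡ ℕ→ℚ a * ℕ→ℚ b
  ℕ→ℚ-* a b rewrite ℕ→ℚ≡mkℚ a | ℕ→ℚ≡mkℚ b = /-cong (ℤ.pos-* a b) refl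

  ℕ→ℚ-mono-≤ : ∀ {a b} → a ℕ.≤ b → ℕ→ℚ a ≤ ℕ→ℚ b
  ℕ→ℚ-mono-≤ {a} {b} a≤b rewrite ℕ→ℚ≡mkℚ a | ℕ→ℚ≡mkℚ b =
    *≤* (subst₂ ℤ._≤_ (sym (ℤ.*-identityʳ (ℤ.+ a))) (sym (ℤ.*-identityʳ (ℤ.+ b))) (ℤ.+≤+ a≤b))

  0≤ℕ→ℚ : ∀ n → 0ℚ ≤ ℕ→ℚ n
  0≤ℕ→ℚ n = ℕ→ℚ-mono-≤ {0} {n} ℕ.z≤n

  ℕ→ℚ-pos : ∀ n .{{_ : NonZero n}} → Positive (ℕ→ℚ n)
  ℕ→ℚ-pos n = normalize-pos n 1

  ℕ→ℚ*/ : ∀ a d .{{_ : NonZero d}} → ℕ→ℚ d * (ℤ.+ a / d) ≡ ℕ→ℚ a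
  ℕ→ℚ*/ a (suc b) = toℚᵘ-injective (ℚᵘ.≃-trans (toℚᵘ-homo-* (ℕ→ℚ (suc b)) (ℤ.+ a / suc b))
    (ℚᵘ.≃-trans (ℚᵘ.*-cong (toℚᵘ-fromℚᵘ (ℚᵘ.mkℚᵘ (ℤ.+ suc b) 0)) (toℚᵘ-fromℚᵘ (ℚᵘ.mkℚᵘ (ℤ.+ a) b)))
    (ℚᵘ.≃-trans (ℚᵘ.*≡* cross) (ℚᵘ.≃-sym (toℚᵘ-fromℚᵘ (ℚᵘ.mkℚᵘ (ℤ.+ a) 0))))))
    where
    cross : (ℤ.+ suc b ℤ.* ℤ.+ a) ℤ.* ℤ.+ 1 ≡ ℤ.+ a ℤ.* ℤ.+ (1 ℕ.* suc b)
    cross = trans (ℤ.*-identityʳ _)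
      (trans (ℤ.*-comm (ℤ.+ suc b) (ℤ.+ a)) (cong (λ k → ℤ.+ a ℤ.* ℤ.+ k) (sym (ℕ.*-identityˡ (suc b)))))

  ℚ-ring : ACR.AlmostCommutativeRing _ _
  ℚ-ring = ACR.fromCommutativeRing +-*-commutativeRing (λ x → dec⇒maybe (0ℚ ≟ x))

  0≤p*q : ∀ {p q} → 0ℚ ≤ p → 0ℚ ≤ q → 0ℚ ≤ p * q
  0≤p*q {p} {q} 0≤p 0≤q =
    nonNegative⁻¹ (p * q) {{nonNeg*nonNeg⇒nonNeg p {{nonNegative 0≤p}} q {{nonNegative 0≤q}}}}

  *-cancelˡ-≡-pos : ∀ r .{{_ : Positive r}} {p q} → r * p ≡ r * q → p ≡ q
  *-cancelˡ-≡-pos r rp≡rq =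
    ≤-antisym (*-cancelˡ-≤-pos r (≤-reflexive rp≡rq)) (*-cancelˡ-≤-pos r (≤-reflexive (sym rp≡rq)))

  p²<q² : ∀ {p q} → 0ℚ ≤ p → p < q → p * p < q * q
  p²<q² {p} {q} 0≤p p<q = begin-strict
    p * p  ≤⟨ *-monoˡ-≤-nonNeg p {{nonNegative 0≤p}} (<⇒≤ p<q) ⟩
    p * q  <⟨ *-monoˡ-<-pos q {{positive (≤-<-trans 0≤p p<q)}} p<q ⟩
    q * q  ∎
    where open ≤-Reasoning

  p÷q*q≡p : ∀ p q .{{_ : ℚ.NonZero q}} → p ÷ q * q ≡ p
  p÷q*q≡p p q = trans (*-assoc p (1/ q) q) (trans (cong (p *_) (*-inverseˡ q)) (*-identityʳ p))

  ∣p-½∣≤½ : ∀ {p} → 0ℚ ≤ p → p ≤ 1ℚ → abs (p - ½) ≤ ½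
  ∣p-½∣≤½ {p} 0≤p p≤1 with ∣p∣≡p∨∣p∣≡-p (p - ½)
  ... | inj₁ ∣p-½∣≡p-½ = subst (_≤ ½) (sym ∣p-½∣≡p-½) (+-monoˡ-≤ (- ½) p≤1)
  ... | inj₂ ∣p-½∣≡½-p =
    subst (_≤ ½) (sym (trans ∣p-½∣≡½-p (flip p ½))) (+-monoʳ-≤ ½ (neg-antimono-≤ 0≤p))
    where
    flip : ∀ a b → - (a - b) ≡ b + - a
    flip = solve-∀ ℚ-ring

  ≤½*+½*⇒≤ : ∀ {a b} → a ≤ ½ * b + ½ * a → a ≤ b
  ≤½*+½*⇒≤ {a} {b} a≤ = *-cancelˡ-≤-pos ½ (begin
    ½ * a                      ≡⟨ split ½ a ⟩
    (½ + ½) * a - ½ * a        ≡⟨ cong (_- ½ * a) (*-identityˡ a) ⟩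
    a - ½ * a                  ≤⟨ +-monoˡ-≤ (- (½ * a)) a≤ ⟩
    ½ * b + ½ * a - ½ * a      ≡⟨ cancel (½ * b) (½ * a) ⟩
    ½ * b                      ∎)
    where
    open ≤-Reasoning
    split : ∀ h a → h * a ≡ (h + h) * a - h * a
    split = solve-∀ ℚ-ring
    cancel : ∀ x y → x + y - y ≡ x
    cancel = solve-∀ ℚ-ring

  χℚ : ∀ {N} → Subset N → Fin N → ℚ
  χℚ p i = ℕ→ℚ (χ p i)

  ℕ→ℚ-∑ : ∀ {N} (f : Fin N → ℕ) → ℕ→ℚ (ℕΣ.sum f) ≡ ∑ (ℕ→ℚ ∘ f)
  ℕ→ℚ-∑ {zero} f = refl
  ℕ→ℚ-∑ {suc N} f = trans (ℕ→ℚ-+ (f zero) _) (cong (_+_ (ℕ→ℚ (f zero))) (ℕ→ℚ-∑ (f ∘ suc)))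

  ℕ→ℚ-∣∣ : ∀ {N} (p : Subset N) → ℕ→ℚ ∣ p ∣ ≡ ∑ (χℚ p)
  ℕ→ℚ-∣∣ p = trans (cong ℕ→ℚ (∣p∣≡∑χ p)) (ℕ→ℚ-∑ (χ p))

  ∣∑∣≤∑∣∣ : ∀ {N} (f : Fin N → ℚ) → abs (∑ f) ≤ ∑ (abs ∘ f)
  ∣∑∣≤∑∣∣ {zero} f = ≤-refl
  ∣∑∣≤∑∣∣ {suc N} f =
    ≤-trans (∣p+q∣≤∣p∣+∣q∣ (f zero) _) (+-monoʳ-≤ (abs (f zero)) (∣∑∣≤∑∣∣ (f ∘ suc)))

  ∑-mono-≤ : ∀ {N} {f g : Fin N → ℚ} → (∀ i → f i ≤ g i) → ∑ f ≤ ∑ g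
  ∑-mono-≤ {zero} f≤g = ≤-refl
  ∑-mono-≤ {suc N} f≤g = +-mono-≤ (f≤g zero) (∑-mono-≤ (f≤g ∘ suc))

  ∑-mono-< : ∀ {N} {f g : Fin N → ℚ} → (∀ i → f i ≤ g i) → ∀ j → f j < g j → ∑ f < ∑ g
  ∑-mono-< f≤g zero fj<gj = +-mono-<-≤ fj<gj (∑-mono-≤ (f≤g ∘ suc))
  ∑-mono-< f≤g (suc j) fj<gj = +-mono-≤-< (f≤g zero) (∑-mono-< (f≤g ∘ suc) j fj<gj)

  ∣p∣*b<∑χ*g : ∀ {M} (p : Subset M) (g : Fin M → ℚ) {b} → Nonempty p → (∀ {y} → y ∈ p → b < g y) →
    ℕ→ℚ ∣ p ∣ * b < ∑ (λ y → χℚ p y * g y)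
  ∣p∣*b<∑χ*g p g {b} (y₀ , y₀∈p) b<g = begin-strict
    ℕ→ℚ ∣ p ∣ * b             ≡⟨ cong (_* b) (ℕ→ℚ-∣∣ p) ⟩
    ∑ (χℚ p) * b              ≡⟨ ℚΣ.*-distribʳ-sum b (χℚ p) ⟩
    ∑ (λ y → χℚ p y * b)      <⟨ ∑-mono-< pointwise y₀ strict-at-y₀ ⟩
    ∑ (λ y → χℚ p y * g y)    ∎
    where
    open ≤-Reasoning
    pointwise : ∀ y → χℚ p y * b ≤ χℚ p y * g y
    pointwise y with lookup p y in y∈?p
    ... | false = ≤-reflexive (trans (*-zeroˡ b) (sym (*-zeroˡ (g y))))
    ... | true = subst₂ _≤_ (sym (*-identityˡ b)) (sym (*-identityˡ (g y)))
                   (<⇒≤ (b<g (lookup⇒[]= y p y∈?p)))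
    strict-at-y₀ : χℚ p y₀ * b < χℚ p y₀ * g y₀
    strict-at-y₀ rewrite []=⇒lookup y₀∈p =
      subst₂ _<_ (sym (*-identityˡ b)) (sym (*-identityˡ (g y₀))) (b<g y₀∈p)

  popular : ∀ {M} → Subset M → (Fin M → ℚ) → ℚ → Subset M
  popular Y f t = tabulate (λ y → lookup Y y ∧ ⌊ t ≤? abs (f y) ⌋)

  ∈popular⁻ : ∀ {M} {Y : Subset M} {f t y} → y ∈ popular Y f t → y ∈ Y × t ≤ abs (f y)
  ∈popular⁻ {Y = Y} {f} {t} {y} y∈P = split (trans (sym (lookup∘tabulate _ y)) ([]=⇒lookup y∈P))
    where
    split : lookup Y y ∧ ⌊ t ≤? abs (f y) ⌋ ≡ true → y ∈ Y × t ≤ abs (f y)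
    split eq with lookup Y y in y∈Y | t ≤? abs (f y)
    ... | true | yes t≤∣fy∣ = lookup⇒[]= y Y y∈Y , t≤∣fy∣

  ∑-popular : ∀ {M} (Y : Subset M) (f : Fin M → ℚ) {c t} → 0ℚ ≤ t → (∀ y → abs (f y) ≤ c) →
    ∑ (λ y → χℚ Y y * abs (f y)) ≤ c * ℕ→ℚ ∣ popular Y f t ∣ + t * ℕ→ℚ ∣ Y ∣
  ∑-popular Y f {c} {t} 0≤t ∣f∣≤c = begin
    ∑ (λ y → χℚ Y y * abs (f y))
      ≤⟨ ∑-mono-≤ pointwise ⟩
    ∑ (λ y → c * χℚ P y + t * χℚ Y y)
      ≡⟨ ℚΣ.∑-distrib-+ (λ y → c * χℚ P y) (λ y → t * χℚ Y y) ⟩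
    ∑ (λ y → c * χℚ P y) + ∑ (λ y → t * χℚ Y y)
      ≡⟨ cong₂ _+_ (ℚΣ.*-distribˡ-sum c (χℚ P)) (ℚΣ.*-distribˡ-sum t (χℚ Y)) ⟨
    c * ∑ (χℚ P) + t * ∑ (χℚ Y)
      ≡⟨ cong₂ (λ a b → c * a + t * b) (ℕ→ℚ-∣∣ P) (ℕ→ℚ-∣∣ Y) ⟨
    c * ℕ→ℚ ∣ P ∣ + t * ℕ→ℚ ∣ Y ∣ ∎
    where
    open ≤-Reasoning
    P = popular Y f t
    pointwise : ∀ y → χℚ Y y * abs (f y) ≤ c * χℚ P y + t * χℚ Y y
    pointwise y rewrite lookup∘tabulate (λ y → lookup Y y ∧ ⌊ t ≤? abs (f y) ⌋) y
      with lookup Y y | t ≤? abs (f y)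
    ... | false | _ = ≤-reflexive (trans (*-zeroˡ (abs (f y)))
                        (sym (trans (cong₂ _+_ (*-zeroʳ c) (*-zeroʳ t)) (+-identityʳ 0ℚ))))
    ... | true | yes _ = begin
      1ℚ * abs (f y)   ≡⟨ *-identityˡ (abs (f y)) ⟩
      abs (f y)        ≡⟨ +-identityʳ (abs (f y)) ⟨
      abs (f y) + 0ℚ   ≤⟨ +-mono-≤ (∣f∣≤c y) 0≤t ⟩
      c + t            ≡⟨ cong₂ _+_ (*-identityʳ c) (*-identityʳ t) ⟨
      c * 1ℚ + t * 1ℚ  ∎
    ... | true | no t≰∣fy∣ = begin
      1ℚ * abs (f y)   ≡⟨ *-identityˡ (abs (f y)) ⟩
      abs (f y)        ≤⟨ <⇒≤ (≰⇒> t≰∣fy∣) ⟩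
      t                ≡⟨ trans (+-identityˡ (t * 1ℚ)) (*-identityʳ t) ⟨
      0ℚ + t * 1ℚ      ≡⟨ cong (_+ t * 1ℚ) (*-zeroʳ c) ⟨
      c * 0ℚ + t * 1ℚ  ∎

  ℕ→ℚ*frac : ∀ {N} (_∙_ : Op₂ (Fin N)) (inv : Op₁ (Fin N)) a b .{{_ : NonZero b}} →
    ℕ→ℚ b * frac _∙_ inv a b ≡ ℕ→ℚ a
  ℕ→ℚ*frac _ _ a (suc b) = ℕ→ℚ*/ a (suc b)
  ℕ→ℚ*frac _ _ a zero = ⊥-elim (ℕ.≢-nonZero⁻¹ 0 refl)

  module _ {N : ℕ} (_∙_ : Op₂ (Fin N)) (inv : Op₁ (Fin N)) (A X : Subset N)
    .{{_ : NonZero ∣ X ∣}} where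

    private
      n = ℕ→ℚ ∣ X ∣
      h : Fin N → ℕ
      h y = hits _∙_ inv A X ⁅ y ⁆
      d : Fin N → ℚ
      -- σ₁ _∙_ inv A X y is d y - ½ by definition.
      d y = frac _∙_ inv (h y) (∣ X ∣ ℕ.* ∣ ⁅ y ⁆ ∣)
      n*d : ∀ y → n * d y ≡ ℕ→ℚ (h y)
      n*d y = trans (cong (λ k → n * frac _∙_ inv (h y) k) ∣X∣*∣⁅y⁆∣≡∣X∣)
                    (ℕ→ℚ*frac _∙_ inv (h y) ∣ X ∣)
        where
        ∣X∣*∣⁅y⁆∣≡∣X∣ : ∣ X ∣ ℕ.* ∣ ⁅ y ⁆ ∣ ≡ ∣ X ∣
        ∣X∣*∣⁅y⁆∣≡∣X∣ = trans (cong (∣ X ∣ ℕ.*_) (∣⁅x⁆∣≡1 y)) (ℕ.*-identityʳ ∣ X ∣)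

    ∣σ₁∣≤½ : ∀ y → abs (σ₁ _∙_ inv A X y) ≤ ½
    ∣σ₁∣≤½ y = ∣p-½∣≤½ 0≤d d≤1
      where
      0≤d : 0ℚ ≤ d y
      0≤d = *-cancelˡ-≤-pos n {{ℕ→ℚ-pos ∣ X ∣}} (begin
        n * 0ℚ         ≡⟨ *-zeroʳ n ⟩
        0ℚ             ≤⟨ 0≤ℕ→ℚ (h y) ⟩
        ℕ→ℚ (h y)      ≡⟨ n*d y ⟨
        n * d y        ∎)
        where open ≤-Reasoning
      d≤1 : d y ≤ 1ℚ
      d≤1 = *-cancelˡ-≤-pos n {{ℕ→ℚ-pos ∣ X ∣}} (begin
        n * d y        ≡⟨ n*d y ⟩
        ℕ→ℚ (h y)      ≤⟨ ℕ→ℚ-mono-≤ (hits-⁅⁆≤∣X∣ _∙_ {inv} A X y) ⟩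
        n              ≡⟨ *-identityʳ n ⟨
        n * 1ℚ         ∎)
        where open ≤-Reasoning

    σ-average : ∀ Y .{{_ : NonZero ∣ Y ∣}} →
      ℕ→ℚ ∣ Y ∣ * σ _∙_ inv A X Y ≡ ∑ (λ y → χℚ Y y * σ₁ _∙_ inv A X y)
    σ-average Y = begin
      m * (D - ½)
        ≡⟨ *-distribˡ-+ m D (- ½) ⟩
      m * D + m * - ½
        ≡⟨ cong₂ _+_ m*D≡∑χd (cong (_* - ½) (ℕ→ℚ-∣∣ Y)) ⟩
      ∑ (λ y → χℚ Y y * d y) + ∑ (χℚ Y) * - ½
        ≡⟨ cong (_+_ (∑ (λ y → χℚ Y y * d y))) (ℚΣ.*-distribʳ-sum (- ½) (χℚ Y)) ⟩
      ∑ (λ y → χℚ Y y * d y) + ∑ (λ y → χℚ Y y * - ½)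
        ≡⟨ ℚΣ.∑-distrib-+ (λ y → χℚ Y y * d y) (λ y → χℚ Y y * - ½) ⟨
      ∑ (λ y → χℚ Y y * d y + χℚ Y y * - ½)
        ≡⟨ ℚΣ.sum-cong-≗ (λ y → *-distribˡ-+ (χℚ Y y) (d y) (- ½)) ⟨
      ∑ (λ y → χℚ Y y * (d y - ½)) ∎
      where
      open ≡-Reasoning
      m = ℕ→ℚ ∣ Y ∣
      D = frac _∙_ inv (hits _∙_ inv A X Y) (∣ X ∣ ℕ.* ∣ Y ∣)
      m*D≡∑χd : m * D ≡ ∑ (λ y → χℚ Y y * d y)
      m*D≡∑χd = *-cancelˡ-≡-pos n {{ℕ→ℚ-pos ∣ X ∣}} (begin
        n * (m * D)
          ≡⟨ trans (cong (_* D) (ℕ→ℚ-* ∣ X ∣ ∣ Y ∣)) (*-assoc n m D) ⟨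
        ℕ→ℚ (∣ X ∣ ℕ.* ∣ Y ∣) * D
          ≡⟨ ℕ→ℚ*frac _∙_ inv (hits _∙_ inv A X Y) (∣ X ∣ ℕ.* ∣ Y ∣) {{ℕ.m*n≢0 ∣ X ∣ ∣ Y ∣}} ⟩
        ℕ→ℚ (hits _∙_ inv A X Y)
          ≡⟨ trans (cong ℕ→ℚ (hits≡∑hits-⁅⁆ _∙_ {inv} A X Y)) (ℕ→ℚ-∑ (λ y → χ Y y ℕ.* h y)) ⟩
        ∑ (λ y → ℕ→ℚ (χ Y y ℕ.* h y))
          ≡⟨ ℚΣ.sum-cong-≗ (λ y → trans (ℕ→ℚ-* (χ Y y) (h y)) (cong (χℚ Y y *_) (sym (n*d y)))) ⟩
        ∑ (λ y → χℚ Y y * (n * d y))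
          ≡⟨ ℚΣ.sum-cong-≗ (λ y → x∙yz≈y∙xz (χℚ Y y) n (d y)) ⟩
        ∑ (λ y → n * (χℚ Y y * d y))
          ≡⟨ ℚΣ.*-distribˡ-sum n (λ y → χℚ Y y * d y) ⟨
        n * ∑ (λ y → χℚ Y y * d y) ∎)

    popular-large : ∀ Y .{{_ : NonZero ∣ Y ∣}} {ε} → 0ℚ ≤ ε → ε ≤ abs (σ _∙_ inv A X Y) →
      ε * ℕ→ℚ ∣ Y ∣ ≤ ℕ→ℚ ∣ popular Y (σ₁ _∙_ inv A X) (ε * ½) ∣
    popular-large Y {ε} 0≤ε ε≤∣σ∣ = ≤½*+½*⇒≤ (begin
      ε * m                          ≤⟨ *-monoʳ-≤-nonNeg m {{nonNegative (0≤ℕ→ℚ ∣ Y ∣)}} ε≤∣σ∣ ⟩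
      abs σY * m                     ≡⟨ ∣m*σ∣ ⟨
      abs (m * σY)                   ≡⟨ cong abs (σ-average Y) ⟩
      abs (∑ (λ y → χℚ Y y * s y))   ≤⟨ ∣∑∣≤∑∣∣ (λ y → χℚ Y y * s y) ⟩
      ∑ (λ y → abs (χℚ Y y * s y))   ≡⟨ ℚΣ.sum-cong-≗ ∣χ*s∣ ⟩
      ∑ (λ y → χℚ Y y * abs (s y))   ≤⟨ ∑-popular Y s (0≤p*q 0≤ε (<⇒≤ (positive⁻¹ ½))) ∣σ₁∣≤½ ⟩
      ½ * m′ + ε * ½ * m             ≡⟨ cong (_+_ (½ * m′)) (regroup ε ½ m) ⟩
      ½ * m′ + ½ * (ε * m)           ∎)
      where
      open ≤-Reasoning
      m = ℕ→ℚ ∣ Y ∣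
      m′ = ℕ→ℚ ∣ popular Y (σ₁ _∙_ inv A X) (ε * ½) ∣
      σY = σ _∙_ inv A X Y
      s = σ₁ _∙_ inv A X
      ∣m*σ∣ : abs (m * σY) ≡ abs σY * m
      ∣m*σ∣ = trans (∣p*q∣≡∣p∣*∣q∣ m σY)
        (trans (cong (_* abs σY) (0≤p⇒∣p∣≡p (0≤ℕ→ℚ ∣ Y ∣))) (*-comm m (abs σY)))
      ∣χ*s∣ : ∀ y → abs (χℚ Y y * s y) ≡ χℚ Y y * abs (s y)
      ∣χ*s∣ y = trans (∣p*q∣≡∣p∣*∣q∣ (χℚ Y y) (s y))
                      (cong (_* abs (s y)) (0≤p⇒∣p∣≡p (0≤ℕ→ℚ (χ Y y))))
      regroup : ∀ e h m → e * h * m ≡ h * (e * m)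
      regroup = solve-∀ ℚ-ring

  energy-squeeze : ∀ {k n E S : ℕ} {b N K : ℚ} .{{_ : Positive K}} → 0ℚ ≤ b → b < ℕ→ℚ S →
    S ℕ.* S ℕ.≤ k ℕ.* n ℕ.* E → ℕ→ℚ E ≤ _÷_ N K {{pos⇒nonZero K}} → b * b * K < ℕ→ℚ k * ℕ→ℚ n * N
  energy-squeeze {k} {n} {E} {S} {b} {N} {K} 0≤b b<S S²≤knE E≤N÷K = begin-strict
    b * b * K
      <⟨ *-monoˡ-<-pos K (p²<q² 0≤b b<S) ⟩
    ℕ→ℚ S * ℕ→ℚ S * K
      ≡⟨ cong (_* K) (ℕ→ℚ-* S S) ⟨
    ℕ→ℚ (S ℕ.* S) * K
      ≤⟨ *-monoʳ-≤-nonNeg K {{pos⇒nonNeg K}} (ℕ→ℚ-mono-≤ S²≤knE) ⟩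
    ℕ→ℚ (k ℕ.* n ℕ.* E) * K
      ≡⟨ cong (_* K) (trans (ℕ→ℚ-* (k ℕ.* n) E) (cong (_* ℕ→ℚ E) (ℕ→ℚ-* k n))) ⟩
    kn * ℕ→ℚ E * K
      ≤⟨ *-monoʳ-≤-nonNeg K {{pos⇒nonNeg K}} (*-monoˡ-≤-nonNeg kn {{nonNegative 0≤kn}} E≤N÷K) ⟩
    kn * (N ÷ K) * K
      ≡⟨ trans (*-assoc kn (N ÷ K) K) (cong (kn *_) (p÷q*q≡p N K)) ⟩
    kn * N ∎
    where
    open ≤-Reasoning
    instance
      _ = pos⇒nonZero K
    kn = ℕ→ℚ k * ℕ→ℚ n
    0≤kn : 0ℚ ≤ kn
    0≤kn = 0≤p*q (0≤ℕ→ℚ k) (0≤ℕ→ℚ n)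

  rescaling : ∀ n .{{_ : NonZero n}} ε m K →
    ε * ε * ε * ε * m * K * _/_ (ℤ.+ 1) (4 ℕ.* n) {{ℕ.m*n≢0 4 n}} * (ℕ→ℚ n * (ℕ→ℚ n * ℕ→ℚ n * m))
      ≡ ε * m * (ε * ℕ→ℚ n * ½) * (ε * m * (ε * ℕ→ℚ n * ½)) * K
  rescaling n ε m K = begin
    target * P                                   ≡⟨ *-identityʳ (target * P) ⟨
    target * P * 1ℚ                              ≡⟨ polynomial ε m K w nq (ℕ→ℚ 4) ½ ⟩
    b * b * K * (w * (ℕ→ℚ 4 * nq))               ≡⟨ cong (λ x → b * b * K * (w * x)) (ℕ→ℚ-* 4 n) ⟨
    b * b * K * (w * ℕ→ℚ (4 ℕ.* n))              ≡⟨ cong (b * b * K *_) w*4n≡1 ⟩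
    b * b * K * 1ℚ                               ≡⟨ *-identityʳ (b * b * K) ⟩
    b * b * K                                    ∎
    where
    open ≡-Reasoning
    nq = ℕ→ℚ n
    w = _/_ (ℤ.+ 1) (4 ℕ.* n) {{ℕ.m*n≢0 4 n}}
    P = nq * (nq * nq * m)
    b = ε * m * (ε * nq * ½)
    target = ε * ε * ε * ε * m * K * w
    -- f and h stand for 4 and ½, which makes the identity polynomial.
    polynomial : ∀ e m K w n f h → e * e * e * e * m * K * w * (n * (n * n * m)) * (f * (h * h))
                                  ≡ e * m * (e * n * h) * (e * m * (e * n * h)) * K * (w * (f * n))
    polynomial = solve-∀ ℚ-ring
    w*4n≡1 : w * ℕ→ℚ (4 ℕ.* n) ≡ 1ℚ
    w*4n≡1 = trans (*-comm w _) (ℕ→ℚ*/ 1 (4 ℕ.* n) {{ℕ.m*n≢0 4 n}})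

  lower-bound-from-energy : ∀ {n m m′ k S E : ℕ} .{{_ : NonZero n}} {ε K : ℚ} .{{_ : Positive K}} →
    0ℚ ≤ ε →
    ε * ℕ→ℚ m ≤ ℕ→ℚ m′ →
    ℕ→ℚ m′ * (ε * ℕ→ℚ n * ½) < ℕ→ℚ S →
    S ℕ.* S ℕ.≤ k ℕ.* n ℕ.* E →
    ℕ→ℚ E ≤ _÷_ (ℕ→ℚ (n ℕ.* n ℕ.* m)) K {{pos⇒nonZero K}} →
    ε * ε * ε * ε * ℕ→ℚ m * K * _/_ (ℤ.+ 1) (4 ℕ.* n) {{ℕ.m*n≢0 4 n}} < ℕ→ℚ k
  lower-bound-from-energy {n} {m} {m′} {k} {S} {E} {ε} {K} 0≤ε εm≤m′ m′β<S S²≤knE E≤ =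
    *-cancelʳ-<-nonNeg P {{nonNegative 0≤P}} (begin-strict
      target * P                        ≡⟨ rescaling n ε mq K ⟩
      b * b * K                         <⟨ energy-squeeze {k} {n} {E} {S} 0≤b b<S S²≤knE E≤ ⟩
      ℕ→ℚ k * nq * ℕ→ℚ (n ℕ.* n ℕ.* m)  ≡⟨ trans (*-assoc (ℕ→ℚ k) nq _) (cong (λ x → ℕ→ℚ k * (nq * x)) n²m≡) ⟩
      ℕ→ℚ k * P                         ∎)
    where
    open ≤-Reasoning
    nq = ℕ→ℚ n
    mq = ℕ→ℚ m
    P = nq * (nq * nq * mq)
    β = ε * nq * ½
    b = ε * mq * β
    target = ε * ε * ε * ε * mq * K * _/_ (ℤ.+ 1) (4 ℕ.* n) {{ℕ.m*n≢0 4 n}}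
    n²m≡ : ℕ→ℚ (n ℕ.* n ℕ.* m) ≡ nq * nq * mq
    n²m≡ = trans (ℕ→ℚ-* (n ℕ.* n) m) (cong (_* mq) (ℕ→ℚ-* n n))
    0≤P : 0ℚ ≤ P
    0≤P = 0≤p*q (0≤ℕ→ℚ n) (0≤p*q (0≤p*q (0≤ℕ→ℚ n) (0≤ℕ→ℚ n)) (0≤ℕ→ℚ m))
    0≤β : 0ℚ ≤ β
    0≤β = 0≤p*q (0≤p*q 0≤ε (0≤ℕ→ℚ n)) (<⇒≤ (positive⁻¹ ½))
    0≤b : 0ℚ ≤ b
    0≤b = 0≤p*q (0≤p*q 0≤ε (0≤ℕ→ℚ m)) 0≤β
    b<S : b < ℕ→ℚ S
    b<S = ≤-<-trans (*-monoʳ-≤-nonNeg β {{nonNegative 0≤β}} εm≤m′) m′β<S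

  module GreedyFamily {N : ℕ} {_∙_ : Op₂ (Fin N)} {e : Fin N} {_⁻¹ : Op₁ (Fin N)}
    (isAbelianGroup : IsAbelianGroup _≡_ _∙_ e _⁻¹) (X Y A : Subset N)
    .{{_ : NonZero ∣ X ∣}} .{{_ : NonZero ∣ Y ∣}}
    (ε : ℚ) (0<ε : 0ℚ < ε) (ε≤½ : ε ≤ ½) (ε≤∣σ∣ : ε ≤ abs (σ _∙_ _⁻¹ A X Y)) where

    open import Algebra.Properties.Semiring.Sum ℕ.+-*-semiring using (sum-syntax)
    open Counting using (∣translate∣; overlap-energy; ∣⋃map∣≤; ∣p∣≢0⇒Nonempty)

    private
      isGroup = IsAbelianGroup.isGroup isAbelianGroup
      n = ℕ→ℚ ∣ X ∣

    T : Fin N → Subset N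
    T = translate _∙_ _⁻¹ X

    Y′ : Subset N
    Y′ = popular Y (σ₁ _∙_ _⁻¹ A X) (ε * ½)

    ∈Y′⁻ : ∀ {y} → y ∈ Y′ → y ∈ Y × ε * ½ ≤ abs (σ₁ _∙_ _⁻¹ A X y)
    ∈Y′⁻ = ∈popular⁻ {Y = Y} {f = σ₁ _∙_ _⁻¹ A X} {t = ε * ½}

    Y′⊆Y : Y′ ⊆ Y
    Y′⊆Y = proj₁ ∘ ∈Y′⁻

    β : ℚ
    β = ε * n * ½

    Fits : List (Fin N) → Fin N → Set
    Fits zs y = y ∈ Y′ × ℕ→ℚ ∣ T y ∩ ⋃ (List.map T zs) ∣ ≤ β

    fits? : ∀ zs y → Dec (Fits zs y)
    fits? zs y = y ∈? Y′ ×-dec ℕ→ℚ ∣ T y ∩ ⋃ (List.map T zs) ∣ ≤? β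

    fits-antitone : ∀ zs ws y → Fits (zs ++ ws) y → Fits zs y
    fits-antitone zs ws y (y∈Y′ , small) = y∈Y′ , ≤-trans (ℕ→ℚ-mono-≤ (p⊆q⇒∣p∣≤∣q∣ shrink)) small
      where
      ⋃-prefix : ⋃ (List.map T zs) ⊆ ⋃ (List.map T (zs ++ ws))
      ⋃-prefix = ⋃-least {ps = List.map T zs}
        (λ p∈ → ⊆⋃ (subst (_ ∈ₗ_) (sym (map-++ T zs ws)) (∈-++⁺ˡ p∈)))
      shrink : T y ∩ ⋃ (List.map T zs) ⊆ T y ∩ ⋃ (List.map T (zs ++ ws))
      shrink x∈ with x∈T , x∈⋃ ← x∈p∩q⁻ (T y) _ x∈ = x∈p∩q⁺ (x∈T , ⋃-prefix x∈⋃)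

    open Greedy Fits fits?

    ys : List (Fin N)
    ys = greedy [] (allFin N)

    U : Subset N
    U = ⋃ (List.map T ys)

    ys-chain : Chain Fits ys
    ys-chain = greedy-chain [] (allFin N) (λ ())

    ys⊆Y′ : All (_∈ Y′) ys
    ys⊆Y′ = Chain⇒All {P = Fits} proj₁ ys ys-chain

    ys⊆Y : All (_∈ Y) ys
    ys⊆Y = All.map Y′⊆Y ys⊆Y′

    ys-popular : All (λ y → ε * ½ ≤ abs (σ₁ _∙_ _⁻¹ A X y)) ys
    ys-popular = All.map (proj₂ ∘ ∈Y′⁻) ys⊆Y′

    -- The only use of ε ≤ ½: a kept translate meets U in all of its n > β points.
    β<∣X∣ : β < n
    β<∣X∣ = begin-strict
      ε * n * ½      ≤⟨ *-monoʳ-≤-nonNeg ½ (*-monoʳ-≤-nonNeg n {{nonNegative (0≤ℕ→ℚ ∣ X ∣)}} ε≤½) ⟩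
      ½ * n * ½      ≡⟨ xy∙z≈xz∙y ½ n ½ ⟩
      ½ * ½ * n      <⟨ *-monoˡ-<-pos n {{ℕ→ℚ-pos ∣ X ∣}} (from-yes (½ * ½ <? 1ℚ)) ⟩
      1ℚ * n         ≡⟨ *-identityˡ n ⟩
      n              ∎
      where open ≤-Reasoning

    ys-maximal : ∀ {y} → y ∈ Y′ → β < ℕ→ℚ ∣ T y ∩ U ∣
    ys-maximal {y} y∈Y′ =
      [ chosen , rejected ]′ (greedy-maximal fits-antitone [] (allFin N) (∈-allFin y))
      where
      chosen : y ∈ₗ ys → β < ℕ→ℚ ∣ T y ∩ U ∣
      chosen y∈ys = <-≤-trans β<∣X∣
        (ℕ→ℚ-mono-≤ (subst (ℕ._≤ ∣ T y ∩ U ∣) (∣translate∣ isGroup X y) (p⊆q⇒∣p∣≤∣q∣ Ty⊆Ty∩U)))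
        where
        Ty⊆Ty∩U : T y ⊆ T y ∩ U
        Ty⊆Ty∩U x∈T = x∈p∩q⁺ (x∈T , ⊆⋃ (∈-map⁺ T y∈ys) x∈T)
      rejected : ¬ Fits ys y → β < ℕ→ℚ ∣ T y ∩ U ∣
      rejected ¬fits = ≰⇒> (¬fits ∘ (y∈Y′ ,_))

    S : ℕ
    S = ∑[ y < N ] (χ Y′ y ℕ.* ∣ T y ∩ U ∣)

    S²≤knE : S ℕ.* S ℕ.≤ List.length ys ℕ.* ∣ X ∣ ℕ.* energy _∙_ _⁻¹ X Y
    S²≤knE = ℕ.≤-trans (overlap-energy isGroup X U Y′⊆Y)
      (ℕ.*-monoˡ-≤ (energy _∙_ _⁻¹ X Y) (∣⋃map∣≤ T (ℕ.≤-reflexive ∘ ∣translate∣ isGroup X) ys))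

    εm≤m′ : ε * ℕ→ℚ ∣ Y ∣ ≤ ℕ→ℚ ∣ Y′ ∣
    εm≤m′ = popular-large _∙_ _⁻¹ A X Y (<⇒≤ 0<ε) ε≤∣σ∣

    Y′-nonempty : Nonempty Y′
    Y′-nonempty = ∣p∣≢0⇒Nonempty (λ ∣Y′∣≡0 →
      <-irrefl refl (<-≤-trans 0<εm (subst (λ k → ε * ℕ→ℚ ∣ Y ∣ ≤ ℕ→ℚ k) ∣Y′∣≡0 εm≤m′)))
      where
      0<εm : 0ℚ < ε * ℕ→ℚ ∣ Y ∣
      0<εm = positive⁻¹ _ {{pos*pos⇒pos ε {{positive 0<ε}} (ℕ→ℚ ∣ Y ∣) {{ℕ→ℚ-pos ∣ Y ∣}}}}

    ∣Y′∣β<S : ℕ→ℚ ∣ Y′ ∣ * β < ℕ→ℚ S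
    ∣Y′∣β<S = subst (ℕ→ℚ ∣ Y′ ∣ * β <_) (sym ℕ→ℚS)
      (∣p∣*b<∑χ*g Y′ (λ y → ℕ→ℚ ∣ T y ∩ U ∣) Y′-nonempty ys-maximal)
      where
      ℕ→ℚS : ℕ→ℚ S ≡ ∑ (λ y → χℚ Y′ y * ℕ→ℚ ∣ T y ∩ U ∣)
      ℕ→ℚS = trans (ℕ→ℚ-∑ (λ y → χ Y′ y ℕ.* ∣ T y ∩ U ∣))
        (ℚΣ.sum-cong-≗ (λ y → ℕ→ℚ-* (χ Y′ y) ∣ T y ∩ U ∣))

    ys-large : ∀ {K} .{{_ : Positive K}} →
      ℕ→ℚ (energy _∙_ _⁻¹ X Y) ≤ _÷_ (ℕ→ℚ (∣ X ∣ ℕ.* ∣ X ∣ ℕ.* ∣ Y ∣)) K {{pos⇒nonZero K}} →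
      ε * ε * ε * ε * ℕ→ℚ ∣ Y ∣ * K * _/_ (ℤ.+ 1) (4 ℕ.* ∣ X ∣) {{ℕ.m*n≢0 4 ∣ X ∣}} < ℕ→ℚ (List.length ys)
    ys-large = lower-bound-from-energy {m′ = ∣ Y′ ∣} {List.length ys} {S} {energy _∙_ _⁻¹ X Y}
      (<⇒≤ 0<ε) εm≤m′ ∣Y′∣β<S S²≤knE

open import Data.Nat using (ℕ; _≤_)
import Data.Nat
open import Data.Nat.Properties using (m*n≢0)
open import Data.Integer using (+_)
open import Data.Rational using (ℚ; _*_; _÷_; _<_; ½; 0ℚ; Positive) renaming (_≤_ to _≤ℚ_; _/_ to _//_; ∣_∣ to abs)
open import Data.Rational.Properties using (pos⇒nonZero)
open import Data.List using (length; lookup; take; map)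
open import Data.Product using (Σ)

corollary15 : (N : ℕ) (_∙_ : Op₂ (Fin N)) (e : Fin N) (_⁻¹ : Op₁ (Fin N))
    → IsAbelianGroup _≡_ _∙_ e _⁻¹
    → (X Y A : Subset N) → Nonempty X → Nonempty Y
    → (n : ℕ) → ∣ X ∣ ≡ n → .{{_ : Data.Nat.NonZero n}}
    → (ε : ℚ) → 0ℚ < ε → ε ≤ℚ ½
    → (K : ℚ) → .{{_ : Positive K}}
    → ℕ→ℚ (energy _∙_ _⁻¹ X Y) ≤ℚ _÷_ (ℕ→ℚ (n Data.Nat.* n Data.Nat.* ∣ Y ∣)) K {{pos⇒nonZero K}}
    → ε ≤ℚ abs (σ _∙_ _⁻¹ A X Y)
    → Σ (List (Fin N)) λ ys →
        (ε * ε * ε * ε * ℕ→ℚ ∣ Y ∣ * K * _//_ (+ 1) (4 Data.Nat.* n) {{m*n≢0 4 n}} < ℕ→ℚ (length ys))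
        × All (_∈ Y) ys
        × ((i : Fin (length ys)) → 1 ≤ toℕ i
            → ℕ→ℚ ∣ translate _∙_ _⁻¹ X (lookup ys i) ∩ ⋃ (map (translate _∙_ _⁻¹ X) (take (toℕ i) ys)) ∣
              ≤ℚ ε * ℕ→ℚ n * ½)
        × All (λ y → ε * ½ ≤ℚ abs (σ₁ _∙_ _⁻¹ A X y)) ys
corollary15 N _∙_ e _⁻¹ isAG X Y A _ Y≢∅ _ refl ε 0<ε ε≤½ K E≤ ε≤∣σ∣ =
  ys , ys-large E≤
     , ys⊆Y
     , (λ i _ → proj₂ (ys-chain i))
     , ys-popular
  where
  instance
    _ = Counting.Nonempty⇒NonZero Y≢∅
  open Densities.GreedyFamily isAG X Y A ε 0<ε ε≤½ ε≤∣σ∣
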